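{- Let $t$ be a positive integer, let $\Pi_{1} = \prod_{i=1}^{t} (x^i + 1) \in \mathbb{F}_2[x]$, and let $\tilde{\Pi}_{1}$ be the product of the distinct irreducible polynomials in $\mathbb{F}_2[x]$ dividing $\Pi_{1}$. Then $\deg \tilde{\Pi}_{1} \le \lceil t/2 \rceil^2 - \lceil t/2 \rceil + 1$. -}

module Defs where

open import Data.Bool using (Bool; true; false; if_then_else_; _xor_)
open import Data.Nat using (ℕ; zero; suc; pred; _≤_; _*_; _∸_; ⌈_/2⌉)
import Data.Nat as N
open import Data.List using (List; []; _∷_; length; replicate; _++_; map; foldr)
open import Data.List.Membership.Propositional using (_∈_)
open import Data.List.Relation.Unary.All using (All)
open import Data.List.Relation.Unary.Unique.Propositional using (Unique)
open import Data.Product using (∃; _×_)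
open import Data.Sum using (_⊎_)
open import Relation.Binary.PropositionalEquality using (_≡_)

-- Polynomials over 𝔽₂ = Bool (xor as addition, ∧ as multiplication),
-- represented by coefficient lists, constant term first.
-- Trailing zero coefficients are allowed; equality of polynomials is
-- equality after normalisation (stripping trailing zeros).
Poly : Set
Poly = List Bool

private
  cons′ : Bool → Poly → Poly
  cons′ true  []      = true ∷ []
  cons′ false []      = []
  cons′ a     (b ∷ r) = a ∷ b ∷ r

norm : Poly → Poly
norm []      = []
norm (a ∷ p) = cons′ a (norm p)

_≈_ : Poly → Poly → Set
p ≈ q = norm p ≡ norm q

_+_ : Poly → Poly → Poly
[]      + q       = q
(a ∷ p) + []      = a ∷ p
(a ∷ p) + (b ∷ q) = (a xor b) ∷ (p + q)

_·_ : Poly → Poly → Poly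
[]      · q = []
(a ∷ p) · q = (if a then q else []) + (false ∷ (p · q))

one : Poly
one = true ∷ []

X^ : ℕ → Poly
X^ i = replicate i false ++ (true ∷ [])

-- degree (deg 0 := 0 by convention; only applied to nonzero polynomials)
deg : Poly → ℕ
deg p = pred (length (norm p))

_∣_ : Poly → Poly → Set
p ∣ q = ∃ λ r → (p · r) ≈ q

-- irreducible: non-constant (not zero, not a unit), and any factorisation
-- has a unit (= constant nonzero, i.e. degree 0) factor
Irreducible : Poly → Set
Irreducible p = (1 ≤ deg p) × (∀ a b → (a · b) ≈ p → deg a ≡ 0 ⊎ deg b ≡ 0)

prod : List Poly → Poly
prod = foldr _·_ one

Π₁ : ℕ → Poly
Π₁ zero    = one
Π₁ (suc t) = Π₁ t · (X^ (suc t) + one)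

-- L lists exactly the distinct irreducible polynomials dividing P
-- (each once, up to normalisation; over 𝔽₂ every nonzero polynomial is monic)
DistinctIrreducibleDivisors : Poly → List Poly → Set
DistinctIrreducibleDivisors P L =
  All (λ q → Irreducible q × q ∣ P) L
  × Unique (map norm L)
  × (∀ q → Irreducible q → q ∣ P → norm q ∈ map norm L)

bound : ℕ → ℕ
bound t = (⌈ t /2⌉ * ⌈ t /2⌉ ∸ ⌈ t /2⌉) N.+ 1

-- An irreducible q dividing Π₁ divides some x^i + 1 with 1 ≤ i ≤ t.
-- In characteristic 2, x^(2j) + 1 = (x^j + 1)², so q already divides
-- x^(2j+1) + 1 for some 2j + 1 ≤ t, i.e. j < k.  Since
-- x^(2j+1) + 1 = (x + 1)(1 + x + ⋯ + x^(2j)), every such q divides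
--     envelope k = (x + 1) · ∏_{j<k} (1 + x + ⋯ + x^(2j)),
-- a polynomial of degree 1 + Σ_{j<k} 2j = k² − k + 1.  Irreducibles are
-- prime (Euclid's lemma, obtained from Bézout and the division algorithm),
-- so the product of pairwise distinct irreducible divisors of envelope k
-- divides it, and its degree is at most deg (envelope k).

module Submission where

open import Defs
open import Data.Nat using (ℕ; _≤_; NonZero)
open import Data.List using (List)

open import Algebra.Bundles using (CommutativeRing)
open import Data.Bool using (Bool; true; false; _xor_; if_then_else_)
import Data.Bool.Properties as BoolP
open import Data.Empty using (⊥-elim)
open import Data.List using ([]; _∷_; _++_; length; replicate; map; initLast; _∷ʳ′_)
import Data.List.Properties as ListP
open import Data.List.Relation.Unary.All using (All; []; _∷_) renaming (map to All-map)
open import Data.List.Relation.Unary.AllPairs using ([]; _∷_)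
open import Data.List.Relation.Unary.Unique.Propositional using (Unique)
open import Data.Maybe using (nothing)
import Data.Nat as ℕ
open import Data.Nat using (zero; suc; _<_; z≤n; s≤s; ⌈_/2⌉)
open import Data.Nat.Induction using (<-rec)
import Data.Nat.Properties as ℕP
open import Data.Product using (Σ; ∃; _×_; _,_; proj₁)
open import Data.Sum using (_⊎_; inj₁; inj₂; reduce)
open import Relation.Binary.Bundles using (Setoid)
import Relation.Binary.Reasoning.Setoid as SetoidReasoning
open import Relation.Binary.PropositionalEquality
  using (_≡_; refl; sym; trans; cong; cong₂; subst; module ≡-Reasoning)
open import Relation.Nullary using (¬_)
open import Tactic.RingSolver using (solve-∀)
open import Tactic.RingSolver.Core.AlmostCommutativeRing
  using (AlmostCommutativeRing; fromCommutativeRing)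

data IsZero : Poly → Set where
  []-zero : IsZero []
  ∷-zero  : ∀ {p} → IsZero p → IsZero (false ∷ p)

-- p ≋ q: p and q have the same coefficients up to trailing zeros.  It is
-- an inductive presentation of the equality _≈_ of Defs (≋⇒≈, ≈⇒≋) that
-- supports proofs by structural induction.
infix 4 _≋_
data _≋_ : Poly → Poly → Set where
  []≋  : ∀ {q} → IsZero q → [] ≋ q
  ≋[]  : ∀ {a p} → IsZero (a ∷ p) → (a ∷ p) ≋ []
  _∷≋_ : ∀ a {p q} → p ≋ q → (a ∷ p) ≋ (a ∷ q)

≋-refl : ∀ {p} → p ≋ p
≋-refl {[]}    = []≋ []-zero
≋-refl {a ∷ p} = a ∷≋ ≋-refl

≡⇒≋ : ∀ {p q} → p ≡ q → p ≋ q
≡⇒≋ refl = ≋-refl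

≋-sym : ∀ {p q} → p ≋ q → q ≋ p
≋-sym ([]≋ []-zero)    = []≋ []-zero
≋-sym ([]≋ (∷-zero z)) = ≋[] (∷-zero z)
≋-sym (≋[] z)          = []≋ z
≋-sym (a ∷≋ e)         = a ∷≋ ≋-sym e

IsZero⇒≋ : ∀ {p q} → IsZero p → IsZero q → p ≋ q
IsZero⇒≋ []-zero    zq         = []≋ zq
IsZero⇒≋ (∷-zero z) []-zero    = ≋[] (∷-zero z)
IsZero⇒≋ (∷-zero z) (∷-zero w) = false ∷≋ IsZero⇒≋ z w

IsZero-resp : ∀ {p q} → p ≋ q → IsZero p → IsZero q
IsZero-resp ([]≋ z)       _          = z
IsZero-resp (≋[] _)       _          = []-zero
IsZero-resp (false ∷≋ e) (∷-zero z) = ∷-zero (IsZero-resp e z)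

≋-trans : ∀ {p q r} → p ≋ q → q ≋ r → p ≋ r
≋-trans ([]≋ z)  e         = []≋ (IsZero-resp e z)
≋-trans (≋[] z)  ([]≋ w)   = IsZero⇒≋ z w
≋-trans (a ∷≋ e) (≋[] z)   = ≋[] (IsZero-resp (≋-sym (a ∷≋ e)) z)
≋-trans (a ∷≋ e) (.a ∷≋ f) = a ∷≋ ≋-trans e f

IsZero⇒≋[] : ∀ {p} → IsZero p → p ≋ []
IsZero⇒≋[] z = IsZero⇒≋ z []-zero

≋[]⇒IsZero : ∀ {p} → p ≋ [] → IsZero p
≋[]⇒IsZero e = IsZero-resp (≋-sym e) []-zero

≋-setoid : Setoid _ _
≋-setoid = record
  { Carrier       = Poly
  ; _≈_           = _≋_
  ; isEquivalence = record { refl = ≋-refl ; sym = ≋-sym ; trans = ≋-trans }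
  }

module ≋-Reasoning = SetoidReasoning ≋-setoid

-- The step of Defs' normalisation (which is private there): prepend a
-- coefficient to a normal form, dropping a lone trailing zero.
normCons : Bool → Poly → Poly
normCons a     (b ∷ r) = a ∷ b ∷ r
normCons true  []      = true ∷ []
normCons false []      = []

norm-∷ : ∀ a p → norm (a ∷ p) ≡ normCons a (norm p)
norm-∷ a p with norm p
norm-∷ true  p | []    = refl
norm-∷ false p | []    = refl
norm-∷ true  p | _ ∷ _ = refl
norm-∷ false p | _ ∷ _ = refl

IsZero⇒norm[] : ∀ {p} → IsZero p → norm p ≡ []
IsZero⇒norm[] []-zero        = refl
IsZero⇒norm[] (∷-zero {p} z) =
  trans (norm-∷ false p) (cong (normCons false) (IsZero⇒norm[] z))

≋⇒≈ : ∀ {p q} → p ≋ q → p ≈ q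
≋⇒≈ ([]≋ z) = sym (IsZero⇒norm[] z)
≋⇒≈ (≋[] z) = IsZero⇒norm[] z
≋⇒≈ (_∷≋_ a {p} {q} e) =
  trans (norm-∷ a p) (trans (cong (normCons a) (≋⇒≈ e)) (sym (norm-∷ a q)))

≋-norm : ∀ p → p ≋ norm p
≋-norm []      = ≋-refl
≋-norm (a ∷ p) =
  ≋-trans (a ∷≋ ≋-norm p)
          (≋-trans (∷≋normCons a (norm p)) (≡⇒≋ (sym (norm-∷ a p))))
  where
  ∷≋normCons : ∀ a r → (a ∷ r) ≋ normCons a r
  ∷≋normCons a     (b ∷ r) = ≋-refl
  ∷≋normCons true  []      = ≋-refl
  ∷≋normCons false []      = ≋[] (∷-zero []-zero)

≈⇒≋ : ∀ {p q} → p ≈ q → p ≋ q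
≈⇒≋ {p} {q} e = ≋-trans (≋-norm p) (≋-trans (≡⇒≋ e) (≋-sym (≋-norm q)))

+-identityʳ : ∀ p → p + [] ≡ p
+-identityʳ []      = refl
+-identityʳ (a ∷ p) = refl

+-comm : ∀ p q → p + q ≡ q + p
+-comm []      q       = sym (+-identityʳ q)
+-comm (a ∷ p) []      = refl
+-comm (a ∷ p) (b ∷ q) = cong₂ _∷_ (BoolP.xor-comm a b) (+-comm p q)

+-assoc : ∀ p q r → (p + q) + r ≡ p + (q + r)
+-assoc []      q       r       = refl
+-assoc (a ∷ p) []      r       = refl
+-assoc (a ∷ p) (b ∷ q) []      = refl
+-assoc (a ∷ p) (b ∷ q) (c ∷ r)
  rewrite BoolP.xor-assoc a b c | +-assoc p q r = refl

+-self : ∀ p → IsZero (p + p)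
+-self []          = []-zero
+-self (true ∷ p)  = ∷-zero (+-self p)
+-self (false ∷ p) = ∷-zero (+-self p)

+-identityˡ-zero : ∀ {z q} → IsZero z → z + q ≋ q
+-identityˡ-zero            []-zero    = ≋-refl
+-identityˡ-zero {q = []}    (∷-zero z) = ≋[] (∷-zero z)
+-identityˡ-zero {q = b ∷ q} (∷-zero z) = b ∷≋ +-identityˡ-zero z

+-congˡ : ∀ {p p′ q} → p ≋ p′ → p + q ≋ p′ + q
+-congˡ ([]≋ z)           = ≋-sym (+-identityˡ-zero z)
+-congˡ (≋[] z)           = +-identityˡ-zero z
+-congˡ {q = []}    (a ∷≋ e) = a ∷≋ e
+-congˡ {q = b ∷ q} (a ∷≋ e) = (a xor b) ∷≋ +-congˡ e

+-congʳ : ∀ {p q q′} → q ≋ q′ → p + q ≋ p + q′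
+-congʳ {p} {q} {q′} e =
  ≋-trans (≡⇒≋ (+-comm p q)) (≋-trans (+-congˡ e) (≡⇒≋ (+-comm q′ p)))

+-cong : ∀ {p p′ q q′} → p ≋ p′ → q ≋ q′ → p + q ≋ p′ + q′
+-cong e f = ≋-trans (+-congˡ e) (+-congʳ f)

+-interchange : ∀ w x y z → (w + x) + (y + z) ≡ (w + y) + (x + z)
+-interchange w x y z = begin
  (w + x) + (y + z)  ≡⟨ +-assoc w x (y + z) ⟩
  w + (x + (y + z))  ≡⟨ cong (w +_) (sym (+-assoc x y z)) ⟩
  w + ((x + y) + z)  ≡⟨ cong (λ u → w + (u + z)) (+-comm x y) ⟩
  w + ((y + x) + z)  ≡⟨ cong (w +_) (+-assoc y x z) ⟩
  w + (y + (x + z))  ≡⟨ sym (+-assoc w y (x + z)) ⟩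
  (w + y) + (x + z)  ∎
  where open ≡-Reasoning

scale : Bool → Poly → Poly
scale a q = if a then q else []

IsZero-·ˡ : ∀ {p} q → IsZero p → IsZero (p · q)
IsZero-·ˡ q []-zero    = []-zero
IsZero-·ˡ q (∷-zero z) = ∷-zero (IsZero-·ˡ q z)

·-zeroʳ : ∀ p → IsZero (p · [])
·-zeroʳ []          = []-zero
·-zeroʳ (true ∷ p)  = ∷-zero (·-zeroʳ p)
·-zeroʳ (false ∷ p) = ∷-zero (·-zeroʳ p)

·-congˡ : ∀ {p p′ q} → p ≋ p′ → p · q ≋ p′ · q
·-congˡ {q = q} ([]≋ z)           = []≋ (IsZero-·ˡ q z)
·-congˡ {q = q} (≋[] (∷-zero z)) = ≋[] (∷-zero (IsZero-·ˡ q z))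
·-congˡ (true ∷≋ e)              = +-congʳ (false ∷≋ ·-congˡ e)
·-congˡ (false ∷≋ e)             = false ∷≋ ·-congˡ e

·-congʳ : ∀ p {q q′} → q ≋ q′ → p · q ≋ p · q′
·-congʳ []          e = ≋-refl
·-congʳ (true ∷ p)  e = +-cong e (false ∷≋ ·-congʳ p e)
·-congʳ (false ∷ p) e = false ∷≋ ·-congʳ p e

·-cong : ∀ {p p′ q q′} → p ≋ p′ → q ≋ q′ → p · q ≋ p′ · q′
·-cong {p′ = p′} e f = ≋-trans (·-congˡ e) (·-congʳ p′ f)

IsZero-·ʳ : ∀ p {q} → IsZero q → IsZero (p · q)
IsZero-·ʳ p z =
  ≋[]⇒IsZero (≋-trans (·-congʳ p (IsZero⇒≋[] z)) (IsZero⇒≋[] (·-zeroʳ p)))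

·-identityˡ : ∀ q → one · q ≋ q
·-identityˡ q = ≋-trans (≡⇒≋ (+-comm q (false ∷ []))) (+-identityˡ-zero (∷-zero []-zero))

·-∷ʳ : ∀ q a p → q · (a ∷ p) ≋ scale a q + (false ∷ (q · p))
·-∷ʳ []      true  p = []≋ (∷-zero []-zero)
·-∷ʳ []      false p = []≋ (∷-zero []-zero)
·-∷ʳ (c ∷ q) a     p =
  ≋-trans (+-congʳ (false ∷≋ ·-∷ʳ q a p)) (≡⇒≋ (swap c a))
  where
  swap : ∀ c a → scale c (a ∷ p) + (false ∷ (scale a q + (false ∷ (q · p))))
               ≡ scale a (c ∷ q) + (false ∷ (scale c p + (false ∷ (q · p))))
  swap true  true  = cong (true ∷_) (begin
      p + (q + R)  ≡⟨ sym (+-assoc p q R) ⟩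
      (p + q) + R  ≡⟨ cong (_+ R) (+-comm p q) ⟩
      (q + p) + R  ≡⟨ +-assoc q p R ⟩
      q + (p + R)  ∎)
    where
    R : Poly
    R = false ∷ (q · p)
    open ≡-Reasoning
  swap true  false = refl
  swap false true  = refl
  swap false false = refl

·-comm : ∀ p q → p · q ≋ q · p
·-comm []      q = ≋-sym (IsZero⇒≋[] (·-zeroʳ q))
·-comm (a ∷ p) q = ≋-trans (+-congʳ (false ∷≋ ·-comm p q)) (≋-sym (·-∷ʳ q a p))

·-distribʳ : ∀ p q r → (p + q) · r ≋ (p · r) + (q · r)
·-distribʳ []      q       r = ≋-refl
·-distribʳ (a ∷ p) []      r = ≡⇒≋ (sym (+-identityʳ _))
·-distribʳ (a ∷ p) (b ∷ q) r =
  ≋-trans (+-congʳ (false ∷≋ ·-distribʳ p q r)) (split a b)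
  where
  A B : Poly
  A = false ∷ (p · r)
  B = false ∷ (q · r)
  split : ∀ a b → scale (a xor b) r + (false ∷ ((p · r) + (q · r)))
                  ≋ (scale a r + A) + (scale b r + B)
  split true  true  = ≋-sym (≋-trans (≡⇒≋ (+-interchange r A r B))
                                     (+-identityˡ-zero (+-self r)))
  split true  false = ≡⇒≋ (sym (+-assoc r A B))
  split false true  = ≡⇒≋ (trans (sym (+-assoc r A B))
                          (trans (cong (_+ B) (+-comm r A)) (+-assoc A r B)))
  split false false = ≋-refl

·-distribˡ : ∀ p q r → p · (q + r) ≋ (p · q) + (p · r)
·-distribˡ p q r =
  ≋-trans (·-comm p (q + r))
          (≋-trans (·-distribʳ q r p) (+-cong (·-comm q p) (·-comm r p)))

·-assoc : ∀ p q r → (p · q) · r ≋ p · (q · r)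
·-assoc []      q r = ≋-refl
·-assoc (a ∷ p) q r =
  ≋-trans (·-distribʳ (scale a q) (false ∷ (p · q)) r)
          (+-cong (scale-· a) (false ∷≋ ·-assoc p q r))
  where
  scale-· : ∀ a → scale a q · r ≋ scale a (q · r)
  scale-· true  = ≋-refl
  scale-· false = ≋-refl

·-identityʳ : ∀ p → p · one ≋ p
·-identityʳ p = ≋-trans (·-comm p one) (·-identityˡ p)

-- 𝔽₂[x] as a commutative ring (negation is the identity), so that
-- characteristic-free ring identities can be discharged by the ring solver.
polyRing : CommutativeRing _ _
polyRing = record
  { Carrier = Poly
  ; _≈_ = _≋_
  ; _+_ = _+_
  ; _*_ = _·_
  ; -_  = λ p → p
  ; 0#  = []
  ; 1#  = one
  ; isCommutativeRing = record
    { isRing = record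
      { +-isAbelianGroup = record
        { isGroup = record
          { isMonoid = record
            { isSemigroup = record
              { isMagma = record
                { isEquivalence = Setoid.isEquivalence ≋-setoid
                ; ∙-cong        = +-cong }
              ; assoc = λ p q r → ≡⇒≋ (+-assoc p q r) }
            ; identity = (λ _ → ≋-refl) , (λ p → ≡⇒≋ (+-identityʳ p)) }
          ; inverse = (λ p → IsZero⇒≋[] (+-self p)) , (λ p → IsZero⇒≋[] (+-self p))
          ; ⁻¹-cong = λ e → e }
        ; comm = λ p q → ≡⇒≋ (+-comm p q) }
      ; *-cong     = ·-cong
      ; *-assoc    = ·-assoc
      ; *-identity = ·-identityˡ , ·-identityʳ
      ; distrib    = ·-distribˡ , (λ p q r → ·-distribʳ q r p) }
    ; *-comm = ·-comm }
  }

-- polyRing in the form used by the reflective ring solver (which then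
-- never identifies constants with 0).
poly : AlmostCommutativeRing _ _
poly = fromCommutativeRing polyRing (λ _ → nothing)

+-double : ∀ x y → x + (y + y) ≋ x
+-double x y = ≋-trans (+-congʳ (IsZero⇒≋[] (+-self y))) (≡⇒≋ (+-identityʳ x))

square-+ : ∀ a b → (a + b) · (a + b) ≋ (a · a) + (b · b)
square-+ a b = ≋-trans (expand a b) (+-double ((a · a) + (b · b)) (a · b))
  where
  expand : ∀ a b → (a + b) · (a + b) ≋ ((a · a) + (b · b)) + ((a · b) + (a · b))
  expand = solve-∀ poly

-- top s: the polynomial with lower coefficients s and leading coefficient
-- 1 in degree length s.  Over 𝔽₂ every nonzero polynomial has this form.
top : Poly → Poly
top s = s ++ true ∷ []

HasDeg : Poly → ℕ → Set
HasDeg p d = Σ Poly λ s → (p ≋ top s) × (length s ≡ d)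

length-snoc : ∀ (s : Poly) x → length (s ++ x ∷ []) ≡ suc (length s)
length-snoc []      x = refl
length-snoc (a ∷ s) x = cong suc (length-snoc s x)

top-nonzero : ∀ s → ¬ IsZero (top s)
top-nonzero []      ()
top-nonzero (a ∷ s) (∷-zero z) = top-nonzero s z

norm-top : ∀ s → norm (top s) ≡ top s
norm-top []      = refl
norm-top (a ∷ s) =
  trans (norm-∷ a (top s)) (trans (cong (normCons a) (norm-top s)) (nonempty s))
  where
  nonempty : ∀ s → normCons a (top s) ≡ a ∷ top s
  nonempty []      = refl
  nonempty (_ ∷ _) = refl

HasDeg⇒deg : ∀ {p d} → HasDeg p d → deg p ≡ d
HasDeg⇒deg (s , p≋ , refl) =
  cong ℕ.pred (trans (cong length (trans (≋⇒≈ p≋) (norm-top s))) (length-snoc s true))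

HasDeg-resp : ∀ {p q d} → p ≋ q → HasDeg p d → HasDeg q d
HasDeg-resp p≋q (s , p≋ , len) = s , ≋-trans (≋-sym p≋q) p≋ , len

HasDeg⇒nonzero : ∀ {p d} → HasDeg p d → ¬ IsZero p
HasDeg⇒nonzero (s , p≋ , _) z = top-nonzero s (IsZero-resp p≋ z)

zero-or-top : ∀ p → IsZero p ⊎ Σ Poly (λ s → p ≋ top s)
zero-or-top [] = inj₁ []-zero
zero-or-top (false ∷ p) with zero-or-top p
... | inj₁ z        = inj₁ (∷-zero z)
... | inj₂ (s , p≋) = inj₂ (false ∷ s , false ∷≋ p≋)
zero-or-top (true ∷ p) with zero-or-top p
... | inj₁ z        = inj₂ ([] , true ∷≋ IsZero⇒≋[] z)
... | inj₂ (s , p≋) = inj₂ (true ∷ s , true ∷≋ p≋)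

zero-or-deg : ∀ p → IsZero p ⊎ HasDeg p (deg p)
zero-or-deg p with zero-or-top p
... | inj₁ z        = inj₁ z
... | inj₂ (s , p≋) = inj₂ (s , p≋ , sym (HasDeg⇒deg (s , p≋ , refl)))

-- By the convention of Defs, deg 0 = 0; so positive degree means nonzero.
deg-zero : ∀ {p} → IsZero p → deg p ≡ 0
deg-zero z = cong (λ r → ℕ.pred (length r)) (IsZero⇒norm[] z)

positive-deg⇒nonzero : ∀ {p} → 1 ≤ deg p → ¬ IsZero p
positive-deg⇒nonzero 1≤deg z = ℕP.<⇒≢ 1≤deg (sym (deg-zero z))

deg-0⇒one : ∀ {p} → ¬ IsZero p → deg p ≡ 0 → p ≋ one
deg-0⇒one {p} p≠0 deg≡0 with zero-or-deg p
... | inj₁ z = ⊥-elim (p≠0 z)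
... | inj₂ ([] , p≋ , _) = p≋
... | inj₂ (_ ∷ _ , _ , len≡) with trans len≡ deg≡0
...   | ()

+-length : ∀ x y → length x ≤ length y → length (x + y) ≡ length y
+-length []      y       _         = refl
+-length (a ∷ x) (b ∷ y) (s≤s x≤y) = cong suc (+-length x y x≤y)

+-++ : ∀ x y z → length x ≤ length y → x + (y ++ z) ≡ (x + y) ++ z
+-++ []      y       z _         = refl
+-++ (a ∷ x) (b ∷ y) z (s≤s x≤y) = cong ((a xor b) ∷_) (+-++ x y z x≤y)

top-· : ∀ s u → Σ Poly λ w → (top s · top u ≡ top w) × (length w ≡ length s ℕ.+ length u)
top-· [] u = u , pad u , refl
  where
  pad : ∀ u → top u + (false ∷ []) ≡ top u
  pad []          = refl
  pad (true ∷ u)  = cong (true ∷_) (+-identityʳ (top u))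
  pad (false ∷ u) = cong (false ∷_) (+-identityʳ (top u))
top-· (a ∷ s) u with top-· s u
... | w , s·u≡ , len-w =
  scale a (top u) + (false ∷ w) ,
  trans (cong (λ v → scale a (top u) + (false ∷ v)) s·u≡)
        (+-++ (scale a (top u)) (false ∷ w) (true ∷ []) (short a)) ,
  trans (+-length (scale a (top u)) (false ∷ w) (short a)) (cong suc len-w)
  where
  short : ∀ a → length (scale a (top u)) ≤ length (false ∷ w)
  short false = z≤n
  short true  = subst (_≤ suc (length w)) (sym (length-snoc u true))
                      (s≤s (subst (length u ≤_) (sym len-w) (ℕP.m≤n+m (length u) (length s))))

HasDeg-· : ∀ {p q d e} → HasDeg p d → HasDeg q e → HasDeg (p · q) (d ℕ.+ e)
HasDeg-· (s , p≋ , refl) (u , q≋ , refl) with top-· s u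
... | w , s·u≡ , len-w = w , ≋-trans (·-cong p≋ q≋) (≡⇒≋ s·u≡) , len-w

infix 4 _∣≋_
record _∣≋_ (p q : Poly) : Set where
  constructor divides
  field
    quotient : Poly
    equation : p · quotient ≋ q

∣⇒∣≋ : ∀ {p q} → p ∣ q → p ∣≋ q
∣⇒∣≋ (r , pr≈q) = divides r (≈⇒≋ pr≈q)

∣≋-refl : ∀ p → p ∣≋ p
∣≋-refl p = divides one (·-identityʳ p)

∣≋-trans : ∀ {a b c} → a ∣≋ b → b ∣≋ c → a ∣≋ c
∣≋-trans {a} (divides r ar≋b) (divides s bs≋c) =
  divides (r · s) (≋-trans (≋-sym (·-assoc a r s)) (≋-trans (·-congˡ ar≋b) bs≋c))

∣≋-respʳ : ∀ {a b c} → b ≋ c → a ∣≋ b → a ∣≋ c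
∣≋-respʳ b≋c (divides r ar≋b) = divides r (≋-trans ar≋b b≋c)

∣≋-respˡ : ∀ {a a′ b} → a ≋ a′ → a ∣≋ b → a′ ∣≋ b
∣≋-respˡ a≋a′ (divides r ar≋b) = divides r (≋-trans (·-congˡ (≋-sym a≋a′)) ar≋b)

∣≋-·ʳ : ∀ {a b} c → a ∣≋ b → a ∣≋ b · c
∣≋-·ʳ {a} c (divides r ar≋b) = divides (r · c) (≋-trans (≋-sym (·-assoc a r c)) (·-congˡ ar≋b))

∣≋-·ˡ : ∀ {a b} c → a ∣≋ b → a ∣≋ c · b
∣≋-·ˡ {b = b} c a∣b = ∣≋-respʳ (·-comm b c) (∣≋-·ʳ c a∣b)

∣≋-+ : ∀ {a b c} → a ∣≋ b → a ∣≋ c → a ∣≋ b + c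
∣≋-+ {a} (divides r ar≋b) (divides s as≋c) =
  divides (r + s) (≋-trans (·-distribˡ a r s) (+-cong ar≋b as≋c))

∣≋⇒deg≤ : ∀ {a P} → ¬ IsZero P → a ∣≋ P → deg a ≤ deg P
∣≋⇒deg≤ {a} {P} P≠0 (divides s as≋P) with zero-or-deg a | zero-or-deg s
... | inj₁ a≡0 | _        = subst (_≤ deg P) (sym (deg-zero a≡0)) z≤n
... | inj₂ _   | inj₁ s≡0 = ⊥-elim (P≠0 (IsZero-resp as≋P (IsZero-·ʳ a s≡0)))
... | inj₂ da  | inj₂ ds  =
  subst (deg a ≤_) (sym (HasDeg⇒deg (HasDeg-resp as≋P (HasDeg-· da ds))))
        (ℕP.m≤m+n (deg a) (deg s))

unit-factorʳ : ∀ p m {q} → p · m ≋ q → ¬ IsZero q → deg m ≡ 0 → m ≋ one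
unit-factorʳ p m pm≋q q≠0 = deg-0⇒one (λ m≡0 → q≠0 (IsZero-resp pm≋q (IsZero-·ʳ p m≡0)))

unit-factorˡ : ∀ p m {q} → p · m ≋ q → ¬ IsZero q → deg p ≡ 0 → p ≋ one
unit-factorˡ p m pm≋q q≠0 = deg-0⇒one (λ p≡0 → q≠0 (IsZero-resp pm≋q (IsZero-·ˡ m p≡0)))

Irreducible⇒nonzero : ∀ {q} → Irreducible q → ¬ IsZero q
Irreducible⇒nonzero (1≤deg , _) = positive-deg⇒nonzero 1≤deg

irreducible-∤-one : ∀ {q} → Irreducible q → ¬ (q ∣≋ one)
irreducible-∤-one (1≤deg , _) q∣1 = ℕP.<⇒≱ 1≤deg (∣≋⇒deg≤ (top-nonzero []) q∣1)

-- In characteristic 2 the leading terms of two polynomials of the same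
-- degree cancel: top w = top s + (s + w).
top-split : ∀ s w → length w ≡ length s → top w ≡ top s + (s + w)
top-split []      []      _    = refl
top-split (b ∷ s) (a ∷ w) len≡ =
  cong₂ _∷_ (sym (xor-cancel b a)) (top-split s w (ℕP.suc-injective len≡))
  where
  xor-cancel : ∀ b a → b xor (b xor a) ≡ a
  xor-cancel b a = trans (sym (BoolP.xor-assoc b b a)) (cong (_xor a) (BoolP.xor-same b))

∷ʳ-false : ∀ w → w ++ false ∷ [] ≋ w
∷ʳ-false []      = ≋[] (∷-zero []-zero)
∷ʳ-false (a ∷ w) = a ∷≋ ∷ʳ-false w

reduce-step : ∀ s w → length w ≡ suc (length s) →
  Σ Poly λ c → Σ Poly λ v → (w ≋ (top s · c) + v) × (length v ≤ length s)
reduce-step s w len-w with initLast w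
... | w₀ ∷ʳ′ false =
  [] , w₀ ,
  ≋-trans (∷ʳ-false w₀) (≋-sym (+-identityˡ-zero (·-zeroʳ (top s)))) ,
  ℕP.≤-reflexive len-w₀
  where
  len-w₀ : length w₀ ≡ length s
  len-w₀ = ℕP.suc-injective (trans (sym (length-snoc w₀ false)) len-w)
... | w₀ ∷ʳ′ true =
  one , s + w₀ ,
  ≋-trans (≡⇒≋ (top-split s w₀ len-w₀)) (+-congˡ (≋-sym (·-identityʳ (top s)))) ,
  ℕP.≤-reflexive (trans (+-length s w₀ (ℕP.≤-reflexive (sym len-w₀))) len-w₀)
  where
  len-w₀ : length w₀ ≡ length s
  len-w₀ = ℕP.suc-injective (trans (sym (length-snoc w₀ true)) len-w)

shift : ∀ S q {a r} c → a ≋ (S · q) + r → (c ∷ a) ≋ (S · (false ∷ q)) + (c ∷ r)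
shift S q c a≋ = ≋-trans (c ∷≋ a≋) (+-congˡ (≋-sym (·-∷ʳ S false q)))

divide : ∀ s a → Σ Poly λ q → Σ Poly λ r → (a ≋ (top s · q) + r) × (length r ≤ length s)
divide s [] =
  [] , [] , ≋-sym (≋-trans (≡⇒≋ (+-identityʳ _)) (IsZero⇒≋[] (·-zeroʳ (top s)))) , z≤n
divide s (c ∷ a) with divide s a
... | q , r , a≋ , r≤ with ℕP.m≤n⇒m<n∨m≡n r≤
...   | inj₁ r< = false ∷ q , c ∷ r , shift (top s) q c a≋ , r<
...   | inj₂ r≡ with reduce-step s (c ∷ r) (cong suc r≡)
...     | q₀ , v , c∷r≋ , v≤ = (false ∷ q) + q₀ , v , c∷a≋ , v≤
  where
  open ≋-Reasoning
  collect : ∀ S Q q₀ v → (S · Q) + ((S · q₀) + v) ≋ (S · (Q + q₀)) + v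
  collect = solve-∀ poly
  c∷a≋ : (c ∷ a) ≋ (top s · ((false ∷ q) + q₀)) + v
  c∷a≋ = begin
    c ∷ a                                          ≈⟨ shift (top s) q c a≋ ⟩
    (top s · (false ∷ q)) + (c ∷ r)                ≈⟨ +-congʳ c∷r≋ ⟩
    (top s · (false ∷ q)) + ((top s · q₀) + v)     ≈⟨ collect (top s) (false ∷ q) q₀ v ⟩
    (top s · ((false ∷ q) + q₀)) + v               ∎

norm-length : ∀ p → length (norm p) ≤ length p
norm-length []      = z≤n
norm-length (a ∷ p) rewrite norm-∷ a p = normCons-length a (norm p) (norm-length p)
  where
  normCons-length : ∀ {n} a r → length r ≤ n → length (normCons a r) ≤ suc n
  normCons-length a     (_ ∷ _) r≤n = s≤s r≤n
  normCons-length true  []      _   = s≤s z≤n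
  normCons-length false []      _   = z≤n

top-length : ∀ {p} s → p ≋ top s → length (top s) ≤ length p
top-length {p} s p≋ =
  subst (_≤ length p) (cong length (trans (≋⇒≈ p≋) (norm-top s))) (norm-length p)

record Bézout (a b : Poly) : Set where
  constructor mkBézout
  field
    gcd u v     : Poly
    gcd∣a       : gcd ∣≋ a
    gcd∣b       : gcd ∣≋ b
    combination : gcd ≋ (u · a) + (v · b)

bézout-zero : ∀ a {b} → IsZero b → Bézout a b
bézout-zero a b≡0 =
  mkBézout a one [] (∣≋-refl a) (divides [] (IsZero⇒≋ (·-zeroʳ a) b≡0))
         (≋-sym (≋-trans (≡⇒≋ (+-identityʳ _)) (·-identityˡ a)))

bézout-step : ∀ {a b q r} → a ≋ (b · q) + r → Bézout b r → Bézout a b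
bézout-step {a} {b} {q} {r} a≋ (mkBézout g u v g∣b g∣r g≋) =
  mkBézout g v (u + (v · q)) g∣a g∣b g≋′
  where
  g∣a : g ∣≋ a
  g∣a = ∣≋-respʳ (≋-sym a≋) (∣≋-+ (∣≋-·ʳ q g∣b) g∣r)
  open ≋-Reasoning
  regroup : ∀ u b v r q → ((u · b) + (v · r)) + (((v · q) · b) + ((v · q) · b))
                          ≋ (v · ((b · q) + r)) + ((u + (v · q)) · b)
  regroup = solve-∀ poly
  g≋′ : g ≋ (v · a) + ((u + (v · q)) · b)
  g≋′ = begin
    g
      ≈⟨ g≋ ⟩
    (u · b) + (v · r)
      ≈⟨ ≋-sym (+-double ((u · b) + (v · r)) ((v · q) · b)) ⟩
    ((u · b) + (v · r)) + (((v · q) · b) + ((v · q) · b))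
      ≈⟨ regroup u b v r q ⟩
    (v · ((b · q) + r)) + ((u + (v · q)) · b)
      ≈⟨ +-congˡ (·-congʳ v (≋-sym a≋)) ⟩
    (v · a) + ((u + (v · q)) · b)
      ∎

-- Euclid's algorithm, by recursion on a bound for the length of b.
bézout-bounded : ∀ n a b → length b ≤ n → Bézout a b
bézout-bounded zero    a []      _     = bézout-zero a []-zero
bézout-bounded (suc n) a b       b≤    with zero-or-top b
... | inj₁ b≡0       = bézout-zero a b≡0
... | inj₂ (s , b≋) with divide s a
... | q , r , a≋ , r≤s =
  bézout-step (≋-trans a≋ (+-congˡ (·-congˡ (≋-sym b≋))))
              (bézout-bounded n b r (ℕP.≤-trans r≤s s≤n))
  where
  s≤n : length s ≤ n
  s≤n = ℕP.≤-pred (subst (_≤ suc n) (length-snoc s true)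
                         (ℕP.≤-trans (top-length s b≋) b≤))

bézout : ∀ a b → Bézout a b
bézout a b = bézout-bounded (length b) a b ℕP.≤-refl

-- Euclid's lemma: irreducible polynomials are prime.  Let g = gcd(a, q) and
-- q ≋ g m; irreducibility makes g or m a unit.
irreducible-prime : ∀ {q} a b → Irreducible q → q ∣≋ a · b → q ∣≋ a ⊎ q ∣≋ b
irreducible-prime {q} a b q-irr@(_ , factors) q∣ab with bézout a q
... | mkBézout g u v g∣a (divides m gm≋q) g≋ with factors g m (≋⇒≈ gm≋q)
-- m is a unit, so q ≋ g divides a.
...   | inj₂ deg-m≡0 = inj₁ (∣≋-respˡ g≋q g∣a)
  where
  m≋1 : m ≋ one
  m≋1 = unit-factorʳ g m gm≋q (Irreducible⇒nonzero q-irr) deg-m≡0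
  g≋q : g ≋ q
  g≋q = ≋-trans (≋-sym (·-identityʳ g)) (≋-trans (·-congʳ g (≋-sym m≋1)) gm≋q)
-- g is a unit, so 1 ≋ u a + v q and b ≋ u (a b) + q (v b) is divisible by q.
...   | inj₁ deg-g≡0 = inj₂ (∣≋-respʳ (≋-sym b≋) q∣sum)
  where
  open ≋-Reasoning
  g≋1 : g ≋ one
  g≋1 = unit-factorˡ g m gm≋q (Irreducible⇒nonzero q-irr) deg-g≡0
  expand : ∀ u a v q b → ((u · a) + (v · q)) · b ≋ (u · (a · b)) + (q · (v · b))
  expand = solve-∀ poly
  b≋ : b ≋ (u · (a · b)) + (q · (v · b))
  b≋ = begin
    b                               ≈⟨ ≋-sym (·-identityˡ b) ⟩
    one · b                         ≈⟨ ·-congˡ (≋-sym g≋1) ⟩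
    g · b                           ≈⟨ ·-congˡ g≋ ⟩
    ((u · a) + (v · q)) · b         ≈⟨ expand u a v q b ⟩
    (u · (a · b)) + (q · (v · b))   ∎
  q∣sum : q ∣≋ (u · (a · b)) + (q · (v · b))
  q∣sum = ∣≋-+ (∣≋-·ˡ u q∣ab) (∣≋-·ʳ (v · b) (∣≋-refl q))

irreducible-∣-square : ∀ {q} p → Irreducible q → q ∣≋ p · p → q ∣≋ p
irreducible-∣-square p q-irr q∣p² = reduce (irreducible-prime p p q-irr q∣p²)

X^-+ : ∀ i j → X^ (i ℕ.+ j) ≋ X^ i · X^ j
X^-+ zero    j = ≋-sym (·-identityˡ (X^ j))
X^-+ (suc i) j = false ∷≋ X^-+ i j

X^-double : ∀ j → X^ (j ℕ.+ j) + one ≋ (X^ j + one) · (X^ j + one)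
X^-double j = ≋-trans (+-congˡ (X^-+ j j)) (≋-sym (square-+ (X^ j) one))

parity : ∀ i → ∃ λ j → i ≡ j ℕ.+ j ⊎ i ≡ suc (j ℕ.+ j)
parity zero = 0 , inj₁ refl
parity (suc i) with parity i
... | j , inj₁ i≡ = j , inj₂ (cong suc i≡)
... | j , inj₂ i≡ = suc j , inj₁ (cong suc (trans i≡ (sym (ℕP.+-suc j j))))

OddDivisor : Poly → ℕ → Set
OddDivisor q i = ∃ λ j → suc (j ℕ.+ j) ≤ i × q ∣≋ X^ (suc (j ℕ.+ j)) + one

-- An irreducible divisor of x^i + 1 (i ≥ 1) divides x^m + 1 for some odd
-- m ≤ i: halve i while it is even, using x^(2j) + 1 = (x^j + 1)².
odd-divisor : ∀ {q} → Irreducible q → ∀ i → 1 ≤ i → q ∣≋ X^ i + one → OddDivisor q i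
odd-divisor {q} q-irr = <-rec Goal step
  where
  Goal : ℕ → Set
  Goal i = 1 ≤ i → q ∣≋ X^ i + one → OddDivisor q i
  half-positive : ∀ j → 1 ≤ j ℕ.+ j → 1 ≤ j
  half-positive (suc j) _ = s≤s z≤n
  step : ∀ i → (∀ {i′} → i′ < i → Goal i′) → Goal i
  step i rec 1≤i q∣ with parity i
  ... | j , inj₂ refl = j , ℕP.≤-refl , q∣
  ... | j , inj₁ refl
    with rec (ℕP.m<m+n j (half-positive j 1≤i)) (half-positive j 1≤i)
             (irreducible-∣-square (X^ j + one) q-irr (∣≋-respʳ (X^-double j) q∣))
  ...   | j′ , odd≤j , q∣′ = j′ , ℕP.≤-trans odd≤j (ℕP.m≤m+n j j) , q∣′

geometric : ℕ → Poly
geometric n = replicate n true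

x+1 : Poly
x+1 = X^ 1 + one

X^-factor : ∀ m → X^ (suc m) + one ≋ x+1 · geometric (suc m)
X^-factor m = begin
  X^ (suc m) + one      ≡⟨ cong (true ∷_) (+-identityʳ (X^ m)) ⟩
  true ∷ X^ m           ≡⟨ cong (true ∷_) (sym (telescope m)) ⟩
  G + (false ∷ G)       ≈⟨ +-congʳ {G} (false ∷≋ ≋-sym (·-identityˡ G)) ⟩
  x+1 · G               ∎
  where
  open ≋-Reasoning
  G : Poly
  G = geometric (suc m)
  telescope : ∀ m → geometric m + (true ∷ geometric m) ≡ X^ m
  telescope zero    = refl
  telescope (suc m) = cong (false ∷_) (telescope m)

oddGeometrics : ℕ → Poly
oddGeometrics zero    = one
oddGeometrics (suc k) = oddGeometrics k · geometric (suc (k ℕ.+ k))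

envelope : ℕ → Poly
envelope k = x+1 · oddGeometrics k

geometric-∣-oddGeometrics : ∀ {j k} → j < k → geometric (suc (j ℕ.+ j)) ∣≋ oddGeometrics k
geometric-∣-oddGeometrics {j} {suc k} (s≤s j≤k) with ℕP.m≤n⇒m<n∨m≡n j≤k
... | inj₁ j<k  = ∣≋-·ʳ (geometric (suc (k ℕ.+ k))) (geometric-∣-oddGeometrics j<k)
... | inj₂ refl = ∣≋-·ˡ (oddGeometrics j) (∣≋-refl _)

Π₁-factor : ∀ {q} → Irreducible q → ∀ t → q ∣≋ Π₁ t →
            ∃ λ i → 1 ≤ i × i ≤ t × q ∣≋ X^ i + one
Π₁-factor q-irr zero    q∣1 = ⊥-elim (irreducible-∤-one q-irr q∣1)
Π₁-factor q-irr (suc t) q∣Π with irreducible-prime (Π₁ t) (X^ (suc t) + one) q-irr q∣Π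
... | inj₂ q∣X = suc t , s≤s z≤n , ℕP.≤-refl , q∣X
... | inj₁ q∣Π′ with Π₁-factor q-irr t q∣Π′
...   | i , 1≤i , i≤t , q∣X = i , 1≤i , ℕP.m≤n⇒m≤1+n i≤t , q∣X

odd≤⇒<⌈/2⌉ : ∀ j t → suc (j ℕ.+ j) ≤ t → j < ⌈ t /2⌉
odd≤⇒<⌈/2⌉ zero    (suc t)       _         = s≤s z≤n
odd≤⇒<⌈/2⌉ (suc j) (suc (suc t)) (s≤s 2j+2≤t+1) =
  s≤s (odd≤⇒<⌈/2⌉ j t (ℕP.≤-pred (subst (_≤ suc t) (cong suc (ℕP.+-suc j j)) 2j+2≤t+1)))

irreducible-∣-envelope : ∀ t {q} → Irreducible q → q ∣≋ Π₁ t → q ∣≋ envelope ⌈ t /2⌉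
irreducible-∣-envelope t q-irr q∣Π with Π₁-factor q-irr t q∣Π
... | i , 1≤i , i≤t , q∣X with odd-divisor q-irr i 1≤i q∣X
... | j , odd≤i , q∣odd
  with irreducible-prime x+1 (geometric (suc (j ℕ.+ j))) q-irr
                         (∣≋-respʳ (X^-factor (j ℕ.+ j)) q∣odd)
... | inj₁ q∣x+1 = ∣≋-·ʳ (oddGeometrics ⌈ t /2⌉) q∣x+1
... | inj₂ q∣geo = ∣≋-·ˡ x+1 (∣≋-trans q∣geo (geometric-∣-oddGeometrics j<k))
  where
  j<k : j < ⌈ t /2⌉
  j<k = odd≤⇒<⌈/2⌉ j t (ℕP.≤-trans odd≤i i≤t)

HasDeg-geometric : ∀ n → HasDeg (geometric (suc n)) n
HasDeg-geometric n = geometric n , ≡⇒≋ (geometric-top n) , ListP.length-replicate n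
  where
  geometric-top : ∀ n → geometric (suc n) ≡ top (geometric n)
  geometric-top zero    = refl
  geometric-top (suc n) = cong (true ∷_) (geometric-top n)

sum-of-evens-step : ∀ k → (k ℕ.* k ℕ.∸ k) ℕ.+ (k ℕ.+ k) ≡ suc k ℕ.* suc k ℕ.∸ suc k
sum-of-evens-step k = begin
  (k ℕ.* k ℕ.∸ k) ℕ.+ (k ℕ.+ k)       ≡⟨ sym (ℕP.+-assoc (k ℕ.* k ℕ.∸ k) k k) ⟩
  ((k ℕ.* k ℕ.∸ k) ℕ.+ k) ℕ.+ k       ≡⟨ cong (ℕ._+ k) (ℕP.m∸n+n≡m (k≤k*k k)) ⟩
  k ℕ.* k ℕ.+ k                       ≡⟨ ℕP.+-comm (k ℕ.* k) k ⟩
  k ℕ.+ k ℕ.* k                       ≡⟨ sym (ℕP.*-suc k k) ⟩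
  k ℕ.* suc k                         ≡⟨ sym (ℕP.m+n∸m≡n (suc k) (k ℕ.* suc k)) ⟩
  suc k ℕ.* suc k ℕ.∸ suc k           ∎
  where
  open ≡-Reasoning
  k≤k*k : ∀ k → k ≤ k ℕ.* k
  k≤k*k zero      = z≤n
  k≤k*k k@(suc _) = ℕP.m≤m*n k k

HasDeg-oddGeometrics : ∀ k → HasDeg (oddGeometrics k) (k ℕ.* k ℕ.∸ k)
HasDeg-oddGeometrics zero    = [] , ≋-refl , refl
HasDeg-oddGeometrics (suc k) =
  subst (HasDeg (oddGeometrics (suc k))) (sum-of-evens-step k)
        (HasDeg-· (HasDeg-oddGeometrics k) (HasDeg-geometric (k ℕ.+ k)))

HasDeg-envelope : ∀ k → HasDeg (envelope k) (suc (k ℕ.* k ℕ.∸ k))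
HasDeg-envelope k = HasDeg-· x+1-deg (HasDeg-oddGeometrics k)
  where
  x+1-deg : HasDeg x+1 1
  x+1-deg = true ∷ [] , ≋-refl , refl

irreducible-∣-irreducible : ∀ {q q′} → Irreducible q → Irreducible q′ → q ∣≋ q′ →
                            norm q ≡ norm q′
irreducible-∣-irreducible {q} (1≤deg , _) q′-irr@(_ , factors′) (divides h qh≋q′)
  with factors′ q h (≋⇒≈ qh≋q′)
... | inj₁ deg-q≡0 = ⊥-elim (ℕP.<⇒≢ 1≤deg (sym deg-q≡0))
... | inj₂ deg-h≡0 = ≋⇒≈ (begin
  q         ≈⟨ ≋-sym (·-identityʳ q) ⟩
  q · one   ≈⟨ ·-congʳ q (≋-sym h≋1) ⟩
  q · h     ≈⟨ qh≋q′ ⟩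
  _         ∎)
  where
  open ≋-Reasoning
  h≋1 : h ≋ one
  h≋1 = unit-factorʳ q h qh≋q′ (Irreducible⇒nonzero q′-irr) deg-h≡0

irreducible-∤-prod : ∀ {q} L → Irreducible q → All Irreducible L →
                     All (λ y → ¬ norm q ≡ y) (map norm L) → ¬ q ∣≋ prod L
irreducible-∤-prod []       q-irr _          _          q∣1 = irreducible-∤-one q-irr q∣1
irreducible-∤-prod (q′ ∷ L) q-irr (q′-irr ∷ irrs) (q≢q′ ∷ q≢L) q∣
  with irreducible-prime q′ (prod L) q-irr q∣
... | inj₁ q∣q′ = q≢q′ (irreducible-∣-irreducible q-irr q′-irr q∣q′)
... | inj₂ q∣L  = irreducible-∤-prod L q-irr irrs q≢L q∣L

prod-∣ : ∀ {P} L → All (λ q → Irreducible q × q ∣≋ P) L → Unique (map norm L) → prod L ∣≋ P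
prod-∣ {P} []      _                  _              = divides P (·-identityˡ P)
prod-∣ {P} (q ∷ L) ((q-irr , q∣P) ∷ ds) (q∉L ∷ distinct) with prod-∣ L ds distinct
... | divides r Lr≋P with irreducible-prime (prod L) r q-irr (∣≋-respʳ (≋-sym Lr≋P) q∣P)
...   | inj₁ q∣L = ⊥-elim (irreducible-∤-prod L q-irr (All-map proj₁ ds) q∉L q∣L)
...   | inj₂ (divides s qs≋r) = divides s (begin
  (q · prod L) · s   ≈⟨ ·-congˡ (·-comm q (prod L)) ⟩
  (prod L · q) · s   ≈⟨ ·-assoc (prod L) q s ⟩
  prod L · (q · s)   ≈⟨ ·-congʳ (prod L) qs≋r ⟩
  prod L · r         ≈⟨ Lr≋P ⟩
  P                  ∎)
  where open ≋-Reasoning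

-- Lemma 3.5: every listed irreducible divides the envelope, hence so does
-- their product (they are pairwise distinct), which bounds its degree.
lemma3p5 : (t : ℕ) → .{{_ : NonZero t}} → (L : List Poly) →
    DistinctIrreducibleDivisors (Π₁ t) L → deg (prod L) ≤ bound t
lemma3p5 t L (divisors , distinct , _) = begin
  deg (prod L)         ≤⟨ ∣≋⇒deg≤ (HasDeg⇒nonzero (HasDeg-envelope k)) prod-L∣envelope ⟩
  deg (envelope k)     ≡⟨ HasDeg⇒deg (HasDeg-envelope k) ⟩
  suc (k ℕ.* k ℕ.∸ k)  ≡⟨ ℕP.+-comm 1 (k ℕ.* k ℕ.∸ k) ⟩
  bound t              ∎
  where
  open ℕP.≤-Reasoning
  k : ℕ
  k = ⌈ t /2⌉
  divisors′ : All (λ q → Irreducible q × q ∣≋ envelope k) L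
  divisors′ = All-map (λ (q-irr , q∣Π) → q-irr , irreducible-∣-envelope t q-irr (∣⇒∣≋ q∣Π))
                      divisors
  prod-L∣envelope : prod L ∣≋ envelope k
  prod-L∣envelope = prod-∣ L divisors′ distinct
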